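{- Let $G$ be a connected cubic graph such that the Sylvester graph $S$ admits a $G$-coloring. Then $G$ is isomorphic to $S$.
   Context: Graphs are finite, undirected, without loops, possibly with multiple edges. For a vertex $v$ of a graph $G$, $\partial_G(v)$ denotes the set of edges incident to $v$. For cubic graphs $G$ and $H$, an $H$-coloring of $G$ is a map $f\colon E(G)\to E(H)$ which is a proper edge-coloring (adjacent edges of $G$ receive distinct edges of $H$) such that for every vertex $x$ of $G$ there is a vertex $y$ of $H$ with $f(\partial_G(x))=\partial_H(y)$; the paper writes $H\prec G$ when $G$ admits an $H$-coloring, so the hypothesis is $G\prec S$. The Sylvester graph $S$ is the cubic multigraph on 10 vertices and 15 edges consisting of a central vertex $c$ and three disjoint blocks $\{w_i,x_i,y_i\}$, $i=1,2,3$, where $c$ is joined to each $w_i$ by a single edge (a bridge), $w_i$ is joined to $x_i$ and to $y_i$ by single edges, and $x_i$ and $y_i$ are joined by two parallel edges. -}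

module Defs where

open import Data.Nat using (ℕ)
open import Data.Fin using (Fin; #_; _≟_)
open import Data.Fin.Properties using (all?)
open import Data.Vec using (Vec; []; _∷_; lookup)
open import Data.Product using (Σ; ∃; ∃-syntax; _×_; _,_)
open import Data.Sum using (_⊎_)
open import Data.Unit using (tt)
open import Relation.Nullary using (¬_; ¬?)
open import Relation.Nullary.Decidable using (toWitness)
open import Relation.Binary.PropositionalEquality using (_≡_; _≢_)
open import Relation.Binary.Construct.Closure.ReflexiveTransitive using (Star)
open import Function.Bundles using (_↔_; Inverse)

record Graph : Set where
  field
    nV nE : ℕ
    src tgt : Fin nE → Fin nV
    noLoop : ∀ e → src e ≢ tgt e

open Graph public

Incident : (G : Graph) → Fin (nE G) → Fin (nV G) → Set
Incident G e v = src G e ≡ v ⊎ tgt G e ≡ v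

Cubic : Graph → Set
Cubic G = ∀ v → Σ (Fin (nE G)) λ e₁ → Σ (Fin (nE G)) λ e₂ → Σ (Fin (nE G)) λ e₃ →
  (e₁ ≢ e₂ × e₁ ≢ e₃ × e₂ ≢ e₃) ×
  (Incident G e₁ v × Incident G e₂ v × Incident G e₃ v) ×
  (∀ e → Incident G e v → e ≡ e₁ ⊎ e ≡ e₂ ⊎ e ≡ e₃)

Adj : (G : Graph) → Fin (nV G) → Fin (nV G) → Set
Adj G u v = ∃[ e ] ((src G e ≡ u × tgt G e ≡ v) ⊎ (src G e ≡ v × tgt G e ≡ u))

Connected : Graph → Set
Connected G = ∀ u v → Star (Adj G) u v

record HColoring (H G : Graph) : Set where
  field
    col : Fin (nE G) → Fin (nE H)
    proper : ∀ e e' x → e ≢ e' → Incident G e x → Incident G e' x → col e ≢ col e'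
    star : ∀ x → ∃[ y ]
      ((∀ e → Incident G e x → Incident H (col e) y) ×
       (∀ e' → Incident H e' y → ∃[ e ] (Incident G e x × col e ≡ e')))

record Iso (G H : Graph) : Set where
  field
    vmap : Fin (nV G) ↔ Fin (nV H)
    emap : Fin (nE G) ↔ Fin (nE H)
    ends : ∀ e →
      (src H (Inverse.to emap e) ≡ Inverse.to vmap (src G e) ×
       tgt H (Inverse.to emap e) ≡ Inverse.to vmap (tgt G e)) ⊎
      (src H (Inverse.to emap e) ≡ Inverse.to vmap (tgt G e) ×
       tgt H (Inverse.to emap e) ≡ Inverse.to vmap (src G e))

-- The Sylvester graph. Vertex 0 = c; for block i ∈ {0,1,2}:
-- w = 1+3i, x = 2+3i, y = 3+3i. Edges of block i (5 each):
-- c–w, w–x, w–y, x–y, x–y.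
sylSrc : Vec (Fin 10) 15
sylSrc = # 0 ∷ # 1 ∷ # 1 ∷ # 2 ∷ # 2 ∷
         # 0 ∷ # 4 ∷ # 4 ∷ # 5 ∷ # 5 ∷
         # 0 ∷ # 7 ∷ # 7 ∷ # 8 ∷ # 8 ∷ []

sylTgt : Vec (Fin 10) 15
sylTgt = # 1 ∷ # 2 ∷ # 3 ∷ # 3 ∷ # 3 ∷
         # 4 ∷ # 5 ∷ # 6 ∷ # 6 ∷ # 6 ∷
         # 7 ∷ # 8 ∷ # 9 ∷ # 9 ∷ # 9 ∷ []

Sylvester : Graph
Sylvester = record
  { nV = 10
  ; nE = 15
  ; src = lookup sylSrc
  ; tgt = lookup sylTgt
  ; noLoop = toWitness {a? = all? (λ e → ¬? (lookup sylSrc e ≟ lookup sylTgt e))} tt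
  }

-- A G-colouring f of S sends each vertex s of S to a vertex φ s of G whose three edges are the
-- colours of the three edges at s, so the pattern of stars of S (the centre, and in each block
-- a vertex w followed by a digon xy) reappears in G. Since an edge of G has only two ends, a
-- case analysis of these incidences shows that the ten vertices φ s are pairwise distinct.
-- Then f maps the ends of each edge to the ends of its colour, so the image of φ is closed
-- under adjacency; G being connected, φ and f are bijections and form an isomorphism.
module Submission where

open import Defs
open import Data.Fin using (Fin; zero; suc; #_; _≟_)
open import Data.Fin.Properties using (all?)
open import Data.Vec using ([]; _∷_; lookup)
open import Data.Product using (∃; _×_; _,_; proj₁; proj₂)
open import Data.Sum using (_⊎_; inj₁; inj₂; map₂) renaming (map to ⊎-map; swap to ⊎-swap)
open import Data.Empty using (⊥; ⊥-elim)
open import Relation.Nullary using (¬_; ¬?; yes; no; Dec)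
open import Relation.Nullary.Decidable using (True; toWitness; map′; _×-dec_; _⊎-dec_; _→-dec_)
open import Relation.Binary.PropositionalEquality using (_≡_; _≢_; refl; sym; trans; cong)
open import Relation.Binary.Construct.Closure.ReflexiveTransitive using (Star; ε; _◅_)
open import Function.Bundles using (mk↔ₛ′)

fin3-pigeonhole : (l m k j : Fin 3) → l ≢ j → m ≢ j → l ≢ m → k ≢ j → l ≡ k ⊎ m ≡ k
fin3-pigeonhole l m k j l≢j m≢j l≢m k≢j with l ≟ k | m ≟ k
... | yes l≡k | _       = inj₁ l≡k
... | no _    | yes m≡k = inj₂ m≡k
... | no l≢k  | no m≢k  = ⊥-elim (no-fourth l m k j (l≢j , m≢j , l≢m , k≢j , l≢k , m≢k))
  where
  no-fourth : ∀ (l m k j : Fin 3) → ¬ (l ≢ j × m ≢ j × l ≢ m × k ≢ j × l ≢ k × m ≢ k)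
  no-fourth = toWitness {a? = all? λ l → all? λ m → all? λ k → all? λ j →
    ¬? (¬? (l ≟ j) ×-dec ¬? (m ≟ j) ×-dec ¬? (l ≟ m) ×-dec ¬? (k ≟ j) ×-dec ¬? (l ≟ k) ×-dec ¬? (m ≟ k))} _

incident? : (G : Graph) → ∀ e v → Dec (Incident G e v)
incident? G e v = (src G e ≟ v) ⊎-dec (tgt G e ≟ v)

record VertexStar (G : Graph) (v : Fin (nV G)) (e₁ e₂ e₃ : Fin (nE G)) : Set where
  field
    distinct₁₂ : e₁ ≢ e₂
    distinct₁₃ : e₁ ≢ e₃
    distinct₂₃ : e₂ ≢ e₃
    incident₁  : Incident G e₁ v
    incident₂  : Incident G e₂ v
    incident₃  : Incident G e₃ v
    exhaustive : ∀ e → Incident G e v → e ≡ e₁ ⊎ e ≡ e₂ ⊎ e ≡ e₃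

vertexStar? : (G : Graph) → ∀ v e₁ e₂ e₃ → Dec (VertexStar G v e₁ e₂ e₃)
vertexStar? G v e₁ e₂ e₃ =
  map′ (λ ((d₁₂ , d₁₃ , d₂₃) , (i₁ , i₂ , i₃) , ex) → record
         { distinct₁₂ = d₁₂ ; distinct₁₃ = d₁₃ ; distinct₂₃ = d₂₃
         ; incident₁ = i₁ ; incident₂ = i₂ ; incident₃ = i₃ ; exhaustive = ex })
       (λ s → let open VertexStar s in
         (distinct₁₂ , distinct₁₃ , distinct₂₃) , (incident₁ , incident₂ , incident₃) , exhaustive)
       ((¬? (e₁ ≟ e₂) ×-dec ¬? (e₁ ≟ e₃) ×-dec ¬? (e₂ ≟ e₃)) ×-dec
        (incident? G e₁ v ×-dec incident? G e₂ v ×-dec incident? G e₃ v) ×-dec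
        all? (λ e → incident? G e v →-dec ((e ≟ e₁) ⊎-dec (e ≟ e₂) ⊎-dec (e ≟ e₃))))

VertexStar-swap₂₃ : ∀ {G v e₁ e₂ e₃} → VertexStar G v e₁ e₂ e₃ → VertexStar G v e₁ e₃ e₂
VertexStar-swap₂₃ s = record
  { distinct₁₂ = distinct₁₃ ; distinct₁₃ = distinct₁₂ ; distinct₂₃ = λ e → distinct₂₃ (sym e)
  ; incident₁ = incident₁ ; incident₂ = incident₃ ; incident₃ = incident₂
  ; exhaustive = λ e i → map₂ ⊎-swap (exhaustive e i) }
  where open VertexStar s

-- The stars of one block w, x, y of the Sylvester graph, or of their images under a colouring:
-- B is the edge cw, A₁ = wx, A₂ = wy, and P, Q are the two parallel edges xy.
record Block (G : Graph) : Set where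
  field
    W X Y : Fin (nV G)
    B A₁ A₂ P Q : Fin (nE G)
    star-W : VertexStar G W B A₁ A₂
    star-X : VertexStar G X A₁ P Q
    star-Y : VertexStar G Y A₂ P Q

  open VertexStar star-W public using () renaming
    (distinct₁₂ to B≢A₁; distinct₁₃ to B≢A₂; distinct₂₃ to A₁≢A₂;
     incident₁ to B∋W; incident₂ to A₁∋W; incident₃ to A₂∋W; exhaustive to at-W)
  open VertexStar star-X public using () renaming
    (distinct₁₂ to A₁≢P; distinct₁₃ to A₁≢Q; distinct₂₃ to P≢Q;
     incident₁ to A₁∋X; incident₂ to P∋X; incident₃ to Q∋X; exhaustive to at-X)
  open VertexStar star-Y public using () renaming
    (distinct₁₂ to A₂≢P;
     incident₁ to A₂∋Y; incident₂ to P∋Y; incident₃ to Q∋Y; exhaustive to at-Y)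

swap : ∀ {G} → Block G → Block G
swap U = record
  { W = W ; X = Y ; Y = X ; B = B ; A₁ = A₂ ; A₂ = A₁ ; P = P ; Q = Q
  ; star-W = VertexStar-swap₂₃ star-W ; star-X = star-Y ; star-Y = star-X }
  where open Block U

record Configuration (G : Graph) : Set where
  field
    C : Fin (nV G)
    block : Fin 3 → Block G
    star-C : VertexStar G C (Block.B (block zero)) (Block.B (block (suc zero)))
                            (Block.B (block (suc (suc zero))))

data Role : Set where
  centre : Role
  w x y  : Fin 3 → Role

vertex : ∀ {G} → Configuration G → Role → Fin (nV G)
vertex K centre = Configuration.C K
vertex K (w i)  = Block.W (Configuration.block K i)
vertex K (x i)  = Block.X (Configuration.block K i)
vertex K (y i)  = Block.Y (Configuration.block K i)

module Incidence (G : Graph) where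

  ends-unique : ∀ {g a b z} → Incident G g a → Incident G g b → a ≢ b → Incident G g z → z ≡ a ⊎ z ≡ b
  ends-unique (inj₁ a) (inj₁ b) a≢b _        = ⊥-elim (a≢b (trans (sym a) b))
  ends-unique (inj₁ a) (inj₂ b) a≢b (inj₁ z) = inj₁ (trans (sym z) a)
  ends-unique (inj₁ a) (inj₂ b) a≢b (inj₂ z) = inj₂ (trans (sym z) b)
  ends-unique (inj₂ a) (inj₁ b) a≢b (inj₁ z) = inj₂ (trans (sym z) b)
  ends-unique (inj₂ a) (inj₁ b) a≢b (inj₂ z) = inj₁ (trans (sym z) a)
  ends-unique (inj₂ a) (inj₂ b) a≢b _        = ⊥-elim (a≢b (trans (sym a) b))

  resp-edge : ∀ {g h v} → g ≡ h → Incident G h v → Incident G g v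
  resp-edge refl i = i

  resp-vertex : ∀ {g u v} → u ≡ v → Incident G g u → Incident G g v
  resp-vertex refl i = i

module Distinctness (G : Graph) where
  open Incidence G

  private
    I : Fin (nE G) → Fin (nV G) → Set
    I = Incident G

  open Block

  A₁∌Y : ∀ (U : Block G) → ¬ I (A₁ U) (Y U)
  A₁∌Y U A₁Y with at-Y U (A₁ U) A₁Y
  ... | inj₁ e        = A₁≢A₂ U e
  ... | inj₂ (inj₁ e) = A₁≢P U e
  ... | inj₂ (inj₂ e) = A₁≢Q U e

  A₂∌X : ∀ (U : Block G) → ¬ I (A₂ U) (X U)
  A₂∌X U = A₁∌Y (swap U)

  X≢Y : ∀ (U : Block G) → X U ≢ Y U
  X≢Y U X≡Y = A₁∌Y U (resp-vertex X≡Y (A₁∋X U))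

  W≢X : ∀ (U : Block G) → W U ≢ X U
  W≢X U W≡X = A₂∌X U (resp-vertex W≡X (A₂∋W U))

  W≢Y : ∀ (U : Block G) → W U ≢ Y U
  W≢Y U = W≢X (swap U)

  no-edge-at-W-X-Y : ∀ (U : Block G) g → I g (X U) → I g (Y U) → ¬ I g (W U)
  no-edge-at-W-X-Y U g gX gY gW with ends-unique gX gY (X≢Y U) gW
  ... | inj₁ e = W≢X U e
  ... | inj₂ e = W≢Y U e

  -- If A₁ U = B V reached W V at X U, then P U and Q U would be A₁ V and A₂ V,
  -- forcing X V = Y U = Y V.
  module _ (U V : Block G) (A₁U≡BV : A₁ U ≡ B V) where

    private
      parallel-edge-at-W-V : W V ≡ X U → ∀ g → I g (X U) → I g (Y U) → g ≢ A₁ U →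
                             (g ≡ A₁ V × X V ≡ Y U) ⊎ (g ≡ A₂ V × Y V ≡ Y U)
      parallel-edge-at-W-V WV≡XU g gX gY g≢A₁U with at-W V g (resp-vertex (sym WV≡XU) gX)
      ... | inj₁ g≡BV = ⊥-elim (g≢A₁U (trans g≡BV (sym A₁U≡BV)))
      ... | inj₂ (inj₁ g≡A₁V) with ends-unique gX gY (X≢Y U) (resp-edge g≡A₁V (A₁∋X V))
      ...   | inj₁ XV≡XU = ⊥-elim (W≢X V (trans WV≡XU (sym XV≡XU)))
      ...   | inj₂ XV≡YU = inj₁ (g≡A₁V , XV≡YU)
      parallel-edge-at-W-V WV≡XU g gX gY g≢A₁U | inj₂ (inj₂ g≡A₂V)
        with ends-unique gX gY (X≢Y U) (resp-edge g≡A₂V (A₂∋Y V))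
      ...   | inj₁ YV≡XU = ⊥-elim (W≢Y V (trans WV≡XU (sym YV≡XU)))
      ...   | inj₂ YV≡YU = inj₂ (g≡A₂V , YV≡YU)

    arm-is-bridge⇒same-W : W V ≡ W U
    arm-is-bridge⇒same-W
      with ends-unique (A₁∋W U) (A₁∋X U) (W≢X U) (resp-edge A₁U≡BV (B∋W V))
    ... | inj₁ e = e
    ... | inj₂ WV≡XU
      with parallel-edge-at-W-V WV≡XU (P U) (P∋X U) (P∋Y U) (λ e → A₁≢P U (sym e))
         | parallel-edge-at-W-V WV≡XU (Q U) (Q∋X U) (Q∋Y U) (λ e → A₁≢Q U (sym e))
    ...   | inj₁ (P≡A₁V , _) | inj₁ (Q≡A₁V , _) = ⊥-elim (P≢Q U (trans P≡A₁V (sym Q≡A₁V)))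
    ...   | inj₂ (P≡A₂V , _) | inj₂ (Q≡A₂V , _) = ⊥-elim (P≢Q U (trans P≡A₂V (sym Q≡A₂V)))
    ...   | inj₁ (_ , XV≡YU) | inj₂ (_ , YV≡YU) = ⊥-elim (X≢Y V (trans XV≡YU (sym YV≡YU)))
    ...   | inj₂ (_ , YV≡YU) | inj₁ (_ , XV≡YU) = ⊥-elim (X≢Y V (trans XV≡YU (sym YV≡YU)))

  same-W-and-A₂⇒same-A₁ : ∀ (U V : Block G) → W V ≡ W U → A₂ V ≡ A₂ U → A₁ V ≡ A₁ U
  same-W-and-A₂⇒same-A₁ U V WV≡WU A₂V≡A₂U = A₁V≡A₁U
    where
    YV≡YU : Y V ≡ Y U
    YV≡YU with ends-unique (A₂∋W U) (A₂∋Y U) (W≢Y U) (resp-edge (sym A₂V≡A₂U) (A₂∋Y V))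
    ... | inj₁ YV≡WU = ⊥-elim (W≢Y V (trans WV≡WU (sym YV≡WU)))
    ... | inj₂ YV≡YU = YV≡YU

    parallel-at-Y-U : ∀ g → I g (Y U) → g ≢ A₂ U → I g (X U) × I g (Y U)
    parallel-at-Y-U g gY g≢A₂U with at-Y U g gY
    ... | inj₁ g≡A₂U       = ⊥-elim (g≢A₂U g≡A₂U)
    ... | inj₂ (inj₁ refl) = P∋X U , P∋Y U
    ... | inj₂ (inj₂ refl) = Q∋X U , Q∋Y U

    XV≡XU : X V ≡ X U
    XV≡XU with parallel-at-Y-U (P V) (resp-vertex YV≡YU (P∋Y V))
                               (λ e → A₂≢P V (trans A₂V≡A₂U (sym e)))
    ... | PX , PY with ends-unique PX PY (X≢Y U) (P∋X V)
    ...   | inj₁ XV≡XU = XV≡XU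
    ...   | inj₂ XV≡YU = ⊥-elim (X≢Y V (trans XV≡YU (sym YV≡YU)))

    A₁V≡A₁U : A₁ V ≡ A₁ U
    A₁V≡A₁U with at-X U (A₁ V) (resp-vertex XV≡XU (A₁∋X V))
    ... | inj₁ e           = e
    ... | inj₂ (inj₁ refl) = ⊥-elim (A₁∌Y V (resp-vertex (sym YV≡YU) (P∋Y U)))
    ... | inj₂ (inj₂ refl) = ⊥-elim (A₁∌Y V (resp-vertex (sym YV≡YU) (Q∋Y U)))

  X≢X : ∀ (U V : Block G) → W U ≢ W V → W U ≢ Y V → X U ≢ X V
  X≢X U V WU≢WV WU≢YV XU≡XV with at-X V (A₁ U) (resp-vertex XU≡XV (A₁∋X U))
  ... | inj₁ refl with ends-unique (A₁∋W V) (A₁∋X V) (W≢X V) (A₁∋W U)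
  ...   | inj₁ WU≡WV = WU≢WV WU≡WV
  ...   | inj₂ WU≡XV = W≢X U (trans WU≡XV (sym XU≡XV))
  X≢X U V WU≢WV WU≢YV XU≡XV | inj₂ (inj₁ refl) with ends-unique (P∋X V) (P∋Y V) (X≢Y V) (A₁∋W U)
  ...   | inj₁ WU≡XV = W≢X U (trans WU≡XV (sym XU≡XV))
  ...   | inj₂ WU≡YV = WU≢YV WU≡YV
  X≢X U V WU≢WV WU≢YV XU≡XV | inj₂ (inj₂ refl) with ends-unique (Q∋X V) (Q∋Y V) (X≢Y V) (A₁∋W U)
  ...   | inj₁ WU≡XV = W≢X U (trans WU≡XV (sym XU≡XV))
  ...   | inj₂ WU≡YV = WU≢YV WU≡YV

  module _ (K : Configuration G) where
    open Configuration K
    open VertexStar star-C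

    bridge : Fin 3 → Fin (nE G)
    bridge l = B (block l)

    bridge∋C : ∀ l → I (bridge l) C
    bridge∋C zero             = incident₁
    bridge∋C (suc zero)       = incident₂
    bridge∋C (suc (suc zero)) = incident₃

    at-C : ∀ g → I g C → ∃ λ l → g ≡ bridge l
    at-C g gC with exhaustive g gC
    ... | inj₁ e        = zero , e
    ... | inj₂ (inj₁ e) = suc zero , e
    ... | inj₂ (inj₂ e) = suc (suc zero) , e

    bridge-injective : ∀ {l m} → bridge l ≡ bridge m → l ≡ m
    bridge-injective {zero}             {zero}             _ = refl
    bridge-injective {zero}             {suc zero}         e = ⊥-elim (distinct₁₂ e)
    bridge-injective {zero}             {suc (suc zero)}   e = ⊥-elim (distinct₁₃ e)
    bridge-injective {suc zero}         {zero}             e = ⊥-elim (distinct₁₂ (sym e))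
    bridge-injective {suc zero}         {suc zero}         _ = refl
    bridge-injective {suc zero}         {suc (suc zero)}   e = ⊥-elim (distinct₂₃ e)
    bridge-injective {suc (suc zero)}   {zero}             e = ⊥-elim (distinct₁₃ (sym e))
    bridge-injective {suc (suc zero)}   {suc zero}         e = ⊥-elim (distinct₂₃ (sym e))
    bridge-injective {suc (suc zero)}   {suc (suc zero)}   _ = refl

    index-≢ : ∀ {g h l m} → g ≡ bridge l → h ≡ bridge m → g ≢ h → l ≢ m
    index-≢ g≡bl h≡bm g≢h l≡m = g≢h (trans g≡bl (trans (cong bridge l≡m) (sym h≡bm)))

    -- If C = W of block i, its arms are two other bridges j and k, so block j also sits at C
    -- and one of its arms is bridge k; agreeing with block i in W and in that arm, block j
    -- then has its remaining arm equal to bridge j, its own B.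
    C≢W : ∀ i → C ≢ W (block i)
    C≢W i C≡WU
      with at-C (A₁ (block i)) (resp-vertex (sym C≡WU) (A₁∋W (block i)))
         | at-C (A₂ (block i)) (resp-vertex (sym C≡WU) (A₂∋W (block i)))
    ... | j , A₁U≡bj | k , A₂U≡bk = contradiction
      where
      U V : Block G
      U = block i
      V = block j
      WV≡WU : W V ≡ W U
      WV≡WU = arm-is-bridge⇒same-W U V A₁U≡bj
      WV≡C : W V ≡ C
      WV≡C = trans WV≡WU (sym C≡WU)
      contradiction : ⊥
      contradiction
        with at-C (A₁ V) (resp-vertex WV≡C (A₁∋W V)) | at-C (A₂ V) (resp-vertex WV≡C (A₂∋W V))
      ... | l , A₁V≡bl | m , A₂V≡bm
        with fin3-pigeonhole l m k j
               (index-≢ A₁V≡bl refl (λ e → B≢A₁ V (sym e)))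
               (index-≢ A₂V≡bm refl (λ e → B≢A₂ V (sym e)))
               (index-≢ A₁V≡bl A₂V≡bm (A₁≢A₂ V))
               (index-≢ A₂U≡bk A₁U≡bj (λ e → A₁≢A₂ U (sym e)))
      ...   | inj₁ refl = B≢A₂ V (sym (trans (same-W-and-A₂⇒same-A₁ U (swap V) WV≡WU
                                                 (trans A₁V≡bl (sym A₂U≡bk))) A₁U≡bj))
      ...   | inj₂ refl = B≢A₁ V (sym (trans (same-W-and-A₂⇒same-A₁ U V WV≡WU
                                                 (trans A₂V≡bm (sym A₂U≡bk))) A₁U≡bj))

    -- A bridge other than B U could only be A₁ U by having C = X U; then P U and Q U
    -- are two further bridges, one of which is B U, which meets W U, X U and Y U.
    bridge≢A₁ : ∀ (U : Block G) {j k} → B U ≡ bridge k → C ≢ W U → j ≢ k → bridge j ≢ A₁ U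
    bridge≢A₁ U {j} {k} BU≡bk C≢WU j≢k bj≡A₁U
      with ends-unique (A₁∋W U) (A₁∋X U) (W≢X U) (resp-edge (sym bj≡A₁U) (bridge∋C j))
    ... | inj₁ C≡WU = C≢WU C≡WU
    ... | inj₂ C≡XU
      with at-C (P U) (resp-vertex (sym C≡XU) (P∋X U)) | at-C (Q U) (resp-vertex (sym C≡XU) (Q∋X U))
    ... | l , P≡bl | m , Q≡bm
      with fin3-pigeonhole l m k j
             (index-≢ P≡bl (sym bj≡A₁U) (λ e → A₁≢P U (sym e)))
             (index-≢ Q≡bm (sym bj≡A₁U) (λ e → A₁≢Q U (sym e)))
             (index-≢ P≡bl Q≡bm (P≢Q U))
             (λ k≡j → j≢k (sym k≡j))
    ...   | inj₁ refl = no-edge-at-W-X-Y U (P U) (P∋X U) (P∋Y U)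
                          (resp-edge (trans P≡bl (sym BU≡bk)) (B∋W U))
    ...   | inj₂ refl = no-edge-at-W-X-Y U (Q U) (Q∋X U) (Q∋Y U)
                          (resp-edge (trans Q≡bm (sym BU≡bk)) (B∋W U))

    W≢W : ∀ {j k} → j ≢ k → W (block j) ≢ W (block k)
    W≢W {j} {k} j≢k Wj≡Wk with at-W (block k) (bridge j) (resp-vertex Wj≡Wk (B∋W (block j)))
    ... | inj₁ bj≡bk        = j≢k (bridge-injective bj≡bk)
    ... | inj₂ (inj₁ bj≡A₁) = bridge≢A₁ (block k) refl (C≢W k) j≢k bj≡A₁
    ... | inj₂ (inj₂ bj≡A₂) = bridge≢A₁ (swap (block k)) refl (C≢W k) j≢k bj≡A₂

    C≢X : ∀ (U : Block G) → C ≢ X U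
    C≢X U C≡XU
      with at-C (P U) (resp-vertex (sym C≡XU) (P∋X U)) | at-C (Q U) (resp-vertex (sym C≡XU) (Q∋X U))
    ... | l , P≡bl | m , Q≡bm with l ≟ m
    ...   | yes l≡m = index-≢ P≡bl Q≡bm (P≢Q U) l≡m
    ...   | no l≢m  = W≢W l≢m (trans (W-is-Y (P U) l (P∋X U) (P∋Y U) P≡bl)
                                     (sym (W-is-Y (Q U) m (Q∋X U) (Q∋Y U) Q≡bm)))
      where
      W-is-Y : ∀ g l → I g (X U) → I g (Y U) → g ≡ bridge l → W (block l) ≡ Y U
      W-is-Y g l gX gY g≡bl with ends-unique gX gY (X≢Y U) (resp-edge g≡bl (B∋W (block l)))
      ... | inj₁ Wl≡XU = ⊥-elim (C≢W l (trans C≡XU (sym Wl≡XU)))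
      ... | inj₂ Wl≡YU = Wl≡YU

    -- An edge of the parallel pair of U would leave W V = X U along B V, A₁ V or A₂ V,
    -- so Y U would be C, X V or Y V; the two parallel edges must take different routes.
    W≢X′ : ∀ j (U : Block G) → W (block j) ≢ X U
    W≢X′ j U WV≡XU
      with far-end (P U) (P∋X U) (P∋Y U) | far-end (Q U) (Q∋X U) (Q∋Y U)
      where
      V : Block G
      V = block j
      far-end : ∀ g → I g (X U) → I g (Y U) →
                (g ≡ B V × C ≡ Y U) ⊎ (g ≡ A₁ V × X V ≡ Y U) ⊎ (g ≡ A₂ V × Y V ≡ Y U)
      far-end g gX gY with at-W V g (resp-vertex (sym WV≡XU) gX)
      ... | inj₁ g≡B with ends-unique gX gY (X≢Y U) (resp-edge g≡B (bridge∋C j))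
      ...   | inj₁ C≡XU = ⊥-elim (C≢W j (trans C≡XU (sym WV≡XU)))
      ...   | inj₂ C≡YU = inj₁ (g≡B , C≡YU)
      far-end g gX gY | inj₂ (inj₁ g≡A₁) with ends-unique gX gY (X≢Y U) (resp-edge g≡A₁ (A₁∋X V))
      ...   | inj₁ XV≡XU = ⊥-elim (W≢X V (trans WV≡XU (sym XV≡XU)))
      ...   | inj₂ XV≡YU = inj₂ (inj₁ (g≡A₁ , XV≡YU))
      far-end g gX gY | inj₂ (inj₂ g≡A₂) with ends-unique gX gY (X≢Y U) (resp-edge g≡A₂ (A₂∋Y V))
      ...   | inj₁ YV≡XU = ⊥-elim (W≢Y V (trans WV≡XU (sym YV≡XU)))
      ...   | inj₂ YV≡YU = inj₂ (inj₂ (g≡A₂ , YV≡YU))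
    ... | inj₁ (P≡ , _)         | inj₁ (Q≡ , _)         = P≢Q U (trans P≡ (sym Q≡))
    ... | inj₂ (inj₁ (P≡ , _))  | inj₂ (inj₁ (Q≡ , _)) = P≢Q U (trans P≡ (sym Q≡))
    ... | inj₂ (inj₂ (P≡ , _))  | inj₂ (inj₂ (Q≡ , _)) = P≢Q U (trans P≡ (sym Q≡))
    ... | inj₁ (_ , a)          | inj₂ (inj₁ (_ , b))  = C≢X (block j) (trans a (sym b))
    ... | inj₂ (inj₁ (_ , b))   | inj₁ (_ , a)         = C≢X (block j) (trans a (sym b))
    ... | inj₁ (_ , a)          | inj₂ (inj₂ (_ , b))  = C≢X (swap (block j)) (trans a (sym b))
    ... | inj₂ (inj₂ (_ , b))   | inj₁ (_ , a)         = C≢X (swap (block j)) (trans a (sym b))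
    ... | inj₂ (inj₁ (_ , a))   | inj₂ (inj₂ (_ , b))  = X≢Y (block j) (trans a (sym b))
    ... | inj₂ (inj₂ (_ , b))   | inj₂ (inj₁ (_ , a))  = X≢Y (block j) (trans a (sym b))

    vertex-injective : ∀ r r′ → vertex K r ≡ vertex K r′ → r ≡ r′
    vertex-injective centre centre _ = refl
    vertex-injective centre (w i)  e = ⊥-elim (C≢W i e)
    vertex-injective centre (x i)  e = ⊥-elim (C≢X (block i) e)
    vertex-injective centre (y i)  e = ⊥-elim (C≢X (swap (block i)) e)
    vertex-injective (w i)  centre e = ⊥-elim (C≢W i (sym e))
    vertex-injective (x i)  centre e = ⊥-elim (C≢X (block i) (sym e))
    vertex-injective (y i)  centre e = ⊥-elim (C≢X (swap (block i)) (sym e))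
    vertex-injective (w j)  (x k)  e = ⊥-elim (W≢X′ j (block k) e)
    vertex-injective (w j)  (y k)  e = ⊥-elim (W≢X′ j (swap (block k)) e)
    vertex-injective (x j)  (w k)  e = ⊥-elim (W≢X′ k (block j) (sym e))
    vertex-injective (y j)  (w k)  e = ⊥-elim (W≢X′ k (swap (block j)) (sym e))
    vertex-injective (w j)  (w k)  e with j ≟ k
    ... | yes refl = refl
    ... | no j≢k   = ⊥-elim (W≢W j≢k e)
    vertex-injective (x j)  (x k)  e with j ≟ k
    ... | yes refl = refl
    ... | no j≢k   = ⊥-elim (X≢X (block j) (block k) (W≢W j≢k) (W≢X′ j (swap (block k))) e)
    vertex-injective (y j)  (y k)  e with j ≟ k
    ... | yes refl = refl
    ... | no j≢k   = ⊥-elim (X≢X (swap (block j)) (swap (block k)) (W≢W j≢k) (W≢X′ j (block k)) e)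
    vertex-injective (x j)  (y k)  e with j ≟ k
    ... | yes refl = ⊥-elim (X≢Y (block j) e)
    ... | no j≢k   = ⊥-elim (X≢X (block j) (swap (block k)) (W≢W j≢k) (W≢X′ j (block k)) e)
    vertex-injective (y j)  (x k)  e with j ≟ k
    ... | yes refl = ⊥-elim (X≢Y (block j) (sym e))
    ... | no j≢k   = ⊥-elim (X≢X (swap (block j)) (block k) (W≢W j≢k) (W≢X′ j (swap (block k))) e)

module Coloring {H K : Graph} (c : HColoring H K) where
  open HColoring c
  open Incidence H using (ends-unique; resp-edge)

  φ : Fin (nV K) → Fin (nV H)
  φ s = proj₁ (star s)

  col-incident : ∀ {e s} → Incident K e s → Incident H (col e) (φ s)
  col-incident {e} {s} = proj₁ (proj₂ (star s)) e

  star-covered : ∀ {s} g → Incident H g (φ s) → ∃ λ e → Incident K e s × col e ≡ g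
  star-covered {s} = proj₂ (proj₂ (star s))

  image-star : ∀ {s e₁ e₂ e₃} → VertexStar K s e₁ e₂ e₃ → VertexStar H (φ s) (col e₁) (col e₂) (col e₃)
  image-star {s} S = record
    { distinct₁₂ = proper _ _ s distinct₁₂ incident₁ incident₂
    ; distinct₁₃ = proper _ _ s distinct₁₃ incident₁ incident₃
    ; distinct₂₃ = proper _ _ s distinct₂₃ incident₂ incident₃
    ; incident₁ = col-incident incident₁
    ; incident₂ = col-incident incident₂
    ; incident₃ = col-incident incident₃
    ; exhaustive = covered
    }
    where
    open VertexStar S
    covered : ∀ g → Incident H g (φ s) → g ≡ col _ ⊎ g ≡ col _ ⊎ g ≡ col _
    covered g gφs with star-covered g gφs
    ... | e , es , refl = ⊎-map (cong col) (⊎-map (cong col) (cong col)) (exhaustive e es)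

  image-block : Block K → Block H
  image-block U = record
    { W = φ W ; X = φ X ; Y = φ Y
    ; B = col B ; A₁ = col A₁ ; A₂ = col A₂ ; P = col P ; Q = col Q
    ; star-W = image-star star-W ; star-X = image-star star-X ; star-Y = image-star star-Y }
    where open Block U

  image-configuration : Configuration K → Configuration H
  image-configuration L = record
    { C = φ C ; block = λ i → image-block (block i) ; star-C = image-star star-C }
    where open Configuration L

  vertex-image : ∀ L r → vertex (image-configuration L) r ≡ φ (vertex L r)
  vertex-image L centre = refl
  vertex-image L (w i)  = refl
  vertex-image L (x i)  = refl
  vertex-image L (y i)  = refl

  module _ (L : Configuration K) where
    open Distinctness H using (vertex-injective)

    spanning⇒φ-injective : (∀ s → ∃ λ r → vertex L r ≡ s) → ∀ {s t} → φ s ≡ φ t → s ≡ t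
    spanning⇒φ-injective spanning {s} {t} φs≡φt with spanning s | spanning t
    ... | r , refl | r′ , refl =
      cong (vertex L) (vertex-injective (image-configuration L) r r′
        (trans (vertex-image L r) (trans φs≡φt (sym (vertex-image L r′)))))

  module _ (φ-injective : ∀ {s t} → φ s ≡ φ t → s ≡ t) where

    ends-of-col : ∀ e {v} → Incident H (col e) v → v ≡ φ (src K e) ⊎ v ≡ φ (tgt K e)
    ends-of-col e = ends-unique (col-incident (inj₁ refl)) (col-incident (inj₂ refl))
                                (λ φs≡φt → noLoop K e (φ-injective φs≡φt))

    endpoint-in-image : ∀ e {v} → Incident H (col e) v → ∃ λ s → φ s ≡ v
    endpoint-in-image e ev with ends-of-col e ev
    ... | inj₁ v≡ = src K e , sym v≡
    ... | inj₂ v≡ = tgt K e , sym v≡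

    neighbour-in-image : ∀ {s v} → Adj H (φ s) v → ∃ λ t → φ t ≡ v
    neighbour-in-image (g , inj₁ (gs , gt)) with star-covered g (inj₁ gs)
    ... | e , _ , refl = endpoint-in-image e (inj₂ gt)
    neighbour-in-image (g , inj₂ (gs , gt)) with star-covered g (inj₂ gt)
    ... | e , _ , refl = endpoint-in-image e (inj₁ gs)

    walk-in-image : ∀ {u v} → Star (Adj H) u v → ∃ (λ s → φ s ≡ u) → ∃ λ t → φ t ≡ v
    walk-in-image ε             image = image
    walk-in-image (step ◅ walk) (s , refl) = walk-in-image walk (neighbour-in-image step)

    col-injective : ∀ {e e′} → col e ≡ col e′ → e ≡ e′
    col-injective {e} {e′} col≡ with e ≟ e′
    ... | yes e≡e′ = e≡e′
    ... | no e≢e′ with ends-of-col e (resp-edge col≡ (col-incident {e′} (inj₁ refl)))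
    ...   | inj₁ φ≡ = ⊥-elim (proper e e′ _ e≢e′ (inj₁ refl) (inj₁ (φ-injective φ≡)) col≡)
    ...   | inj₂ φ≡ = ⊥-elim (proper e e′ _ e≢e′ (inj₂ refl) (inj₁ (φ-injective φ≡)) col≡)

    injective⇒iso : Fin (nV K) → Connected H → Iso H K
    injective⇒iso s₀ connected = record
      { vmap = mk↔ₛ′ ψ φ (λ s → sym (ψ-unique refl)) φψ
      ; emap = mk↔ₛ′ ψₑ col (λ e → col-injective (col-ψₑ (col e))) col-ψₑ
      ; ends = ends
      }
      where
      φ-onto : ∀ v → ∃ λ s → φ s ≡ v
      φ-onto v = walk-in-image (connected (φ s₀) v) (s₀ , refl)

      ψ : Fin (nV H) → Fin (nV K)
      ψ v = proj₁ (φ-onto v)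

      φψ : ∀ v → φ (ψ v) ≡ v
      φψ v = proj₂ (φ-onto v)

      ψ-unique : ∀ {v s} → v ≡ φ s → s ≡ ψ v
      ψ-unique {v} v≡φs = φ-injective (trans (sym v≡φs) (sym (φψ v)))

      col-onto : ∀ g → ∃ λ e → Incident K e (ψ (src H g)) × col e ≡ g
      col-onto g = star-covered g (inj₁ (sym (φψ (src H g))))

      ψₑ : Fin (nE H) → Fin (nE K)
      ψₑ g = proj₁ (col-onto g)

      col-ψₑ : ∀ g → col (ψₑ g) ≡ g
      col-ψₑ g = proj₂ (proj₂ (col-onto g))

      ends : ∀ g →
        (src K (ψₑ g) ≡ ψ (src H g) × tgt K (ψₑ g) ≡ ψ (tgt H g)) ⊎
        (src K (ψₑ g) ≡ ψ (tgt H g) × tgt K (ψₑ g) ≡ ψ (src H g))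
      ends g with ends-of-col (ψₑ g) (resp-edge (col-ψₑ g) (inj₁ refl))
                | ends-of-col (ψₑ g) (resp-edge (col-ψₑ g) (inj₂ refl))
      ... | inj₁ s≡ | inj₂ t≡ = inj₁ (ψ-unique s≡ , ψ-unique t≡)
      ... | inj₂ s≡ | inj₁ t≡ = inj₂ (ψ-unique t≡ , ψ-unique s≡)
      ... | inj₁ s≡ | inj₁ t≡ = ⊥-elim (noLoop H g (trans s≡ (sym t≡)))
      ... | inj₂ s≡ | inj₂ t≡ = ⊥-elim (noLoop H g (trans s≡ (sym t≡)))

sylvester-block : ∀ W X Y B A₁ A₂ P Q →
  {True (vertexStar? Sylvester W B A₁ A₂)} → {True (vertexStar? Sylvester X A₁ P Q)} →
  {True (vertexStar? Sylvester Y A₂ P Q)} → Block Sylvester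
sylvester-block W X Y B A₁ A₂ P Q {star-W} {star-X} {star-Y} = record
  { W = W ; X = X ; Y = Y ; B = B ; A₁ = A₁ ; A₂ = A₂ ; P = P ; Q = Q
  ; star-W = toWitness star-W ; star-X = toWitness star-X ; star-Y = toWitness star-Y }

sylvester-configuration : Configuration Sylvester
sylvester-configuration = record
  { C = # 0
  ; block = λ where
      zero             → sylvester-block (# 1) (# 2) (# 3) (# 0)  (# 1)  (# 2)  (# 3)  (# 4)
      (suc zero)       → sylvester-block (# 4) (# 5) (# 6) (# 5)  (# 6)  (# 7)  (# 8)  (# 9)
      (suc (suc zero)) → sylvester-block (# 7) (# 8) (# 9) (# 10) (# 11) (# 12) (# 13) (# 14)
  ; star-C = toWitness {a? = vertexStar? Sylvester (# 0) (# 0) (# 5) (# 10)} _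
  }

sylvester-spanning : ∀ s → ∃ λ r → vertex sylvester-configuration r ≡ s
sylvester-spanning s = role s , toWitness {a? = all? λ t → vertex sylvester-configuration (role t) ≟ t} _ s
  where
  role : Fin 10 → Role
  role = lookup (centre ∷ w (# 0) ∷ x (# 0) ∷ y (# 0) ∷ w (# 1) ∷ x (# 1) ∷ y (# 1)
                        ∷ w (# 2) ∷ x (# 2) ∷ y (# 2) ∷ [])

theorem2 : (G : Graph) → Cubic G → Connected G → HColoring G Sylvester → Iso G Sylvester
theorem2 G _ connected c =
  injective⇒iso (spanning⇒φ-injective sylvester-configuration sylvester-spanning) (# 0) connected
  where open Coloring c
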